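{- Let $(A,V)$ be a permutation group on a finite set with $A\notin GR\cup\{I_2\}$. If $a\in A'=\bar{A}\setminus A$, then $a$ maps every orbit of $A$ on $V$ onto itself.
   Context: A permutation group $(A,V)$ is a group $A$ of permutations of a set $V$; $I_n$ denotes the trivial group (identity only) acting on an $n$-element set, and groups are considered up to permutation isomorphism. $P_2(V)$ is the set of 2-element subsets of $V$. An edge-colored graph on $V$ is a function $E$ from $P_2(V)$ to a finite set of colors; its automorphisms are the permutations $\sigma$ of $V$ with $E(\{\sigma(v),\sigma(w)\})=E(\{v,w\})$ for all distinct $v,w$. $GR$ is the class of permutation groups that equal the full automorphism group of some edge-colored graph on their underlying set. The NOr-orbitals of $A$ are the orbits of $A$ on $P_2(V)$ under $a\{v,w\}=\{a(v),a(w)\}$. $\bar{A}$ is the smallest permutation group on $V$ containing $A$ and belonging to $GR$ (equivalently, the group of all permutations of $V$ mapping every NOr-orbital of $A$ onto itself). -}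

module Defs where

open import Data.Nat.Base using (ℕ)
open import Data.Fin.Base using (Fin)
open import Data.Fin.Permutation
  using (Permutation′; _⟨$⟩ʳ_; _⟨$⟩ˡ_; _≈_; id; _∘ₚ_; flip)
open import Data.Product.Base using (Σ; ∃; _×_)
open import Data.Sum.Base using (_⊎_)
open import Relation.Binary.PropositionalEquality using (_≡_; _≢_)
open import Relation.Nullary using (¬_)
open import Function.Bundles using (_⇔_)

record PermGroup (n : ℕ) : Set₁ where
  field
    _∈A       : Permutation′ n → Set
    ∈-resp-≈  : ∀ {σ τ} → σ ≈ τ → σ ∈A → τ ∈A
    id-∈      : id ∈A
    ∘-∈       : ∀ {σ τ} → σ ∈A → τ ∈A → (σ ∘ₚ τ) ∈A
    inv-∈     : ∀ {σ} → σ ∈A → flip σ ∈A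

open PermGroup public

SamePair : ∀ {n} → Fin n → Fin n → Fin n → Fin n → Set
SamePair a b c d = (a ≡ c × b ≡ d) ⊎ (a ≡ d × b ≡ c)

-- An edge-colored graph on Fin n with colours Fin k: a colour for each
-- 2-element subset {v,w}, represented as a symmetric function on
-- ordered pairs (values on the diagonal are irrelevant).
record EdgeColoring (n k : ℕ) : Set where
  field
    col : Fin n → Fin n → Fin k
    sym : ∀ v w → col v w ≡ col w v

open EdgeColoring public

IsAut : ∀ {n k} → EdgeColoring n k → Permutation′ n → Set
IsAut E σ = ∀ v w → v ≢ w → col E (σ ⟨$⟩ʳ v) (σ ⟨$⟩ʳ w) ≡ col E v w

InGR : ∀ {n} → PermGroup n → Set
InGR {n} A = Σ ℕ λ k → Σ (EdgeColoring n k) λ E →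
  ∀ σ → ((A ∈A) σ ⇔ IsAut E σ)

IsI₂ : ∀ {n} → PermGroup n → Set
IsI₂ {n} A = n ≡ 2 × (∀ σ → (A ∈A) σ → σ ≈ id)

InNOrOrbit : ∀ {n} → PermGroup n → Fin n → Fin n → Fin n → Fin n → Set
InNOrOrbit A v w x y =
  ∃ λ g → (A ∈A) g × SamePair (g ⟨$⟩ʳ v) (g ⟨$⟩ʳ w) x y

-- σ maps every NOr-orbital of A onto itself:
-- (into) the image of every {v,w} lies in the orbital of {v,w}, and
-- (onto) every member {v,w} of an orbital is the image of a member
-- {x,y} of that same orbital.
-- Ā is the set of such permutations.
InBar : ∀ {n} → PermGroup n → Permutation′ n → Set
InBar A σ =
  (∀ v w → v ≢ w → InNOrOrbit A v w (σ ⟨$⟩ʳ v) (σ ⟨$⟩ʳ w)) ×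
  (∀ v w → v ≢ w → ∃ λ x → ∃ λ y → x ≢ y × InNOrOrbit A v w x y
      × SamePair (σ ⟨$⟩ʳ x) (σ ⟨$⟩ʳ y) v w)

SameOrbit : ∀ {n} → PermGroup n → Fin n → Fin n → Set
SameOrbit A u v = ∃ λ g → (A ∈A) g × g ⟨$⟩ʳ u ≡ v

PreservesOrbits : ∀ {n} → PermGroup n → Permutation′ n → Set
PreservesOrbits A σ =
  (∀ v → SameOrbit A v (σ ⟨$⟩ʳ v)) ×
  (∀ v → ∃ λ u → SameOrbit A v u × σ ⟨$⟩ʳ u ≡ v)

-- For |V| ≥ 3 every point v has a third point z ∉ {v, a v}; following the
-- NOr-orbitals of {v, z} and {v, a⁻¹ z}, which a maps into themselves,
-- either some element of A already sends v to a v, or v ↦ z ↦ a v through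
-- two elements of A.  For |V| ≤ 1 every permutation fixes every point, and
-- for |V| = 2 a permutation outside A moving a point forces A to be trivial,
-- i.e. A = I₂.  Once a moves each point within its orbit, so does a⁻¹,
-- which gives surjectivity on each orbit.
module Submission where

open import Defs hiding (sym)
open import Data.Nat.Base using (ℕ; zero; suc)
open import Data.Fin.Base using (Fin; zero; suc)
open import Data.Fin.Properties using (_≟_)
open import Data.Fin.Permutation
  using (Permutation′; _⟨$⟩ʳ_; _⟨$⟩ˡ_; _≈_; inverseˡ; inverseʳ; id; _∘ₚ_; flip)
open import Data.Product.Base using (∃; _×_; _,_)
open import Data.Sum.Base using (_⊎_; inj₁; inj₂)
open import Data.Empty using (⊥-elim)
open import Function.Bundles using (Injection)
open import Function.Properties.Inverse using (↔⇒↣)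
open import Relation.Nullary using (¬_; yes; no)
open import Relation.Binary.PropositionalEquality
  using (_≡_; _≢_; refl; sym; trans; cong)

⟨$⟩ʳ-injective : ∀ {n} (σ : Permutation′ n) {x y} →
  σ ⟨$⟩ʳ x ≡ σ ⟨$⟩ʳ y → x ≡ y
⟨$⟩ʳ-injective σ = Injection.injective (↔⇒↣ σ)

module _ {n} (A : PermGroup n) where

  SameOrbit-fixed : ∀ (σ : Permutation′ n) {v} → σ ⟨$⟩ʳ v ≡ v →
    SameOrbit A v (σ ⟨$⟩ʳ v)
  SameOrbit-fixed σ σv≡v = id , id-∈ A , sym σv≡v

  SameOrbit-≡-target : ∀ {u v w} → SameOrbit A u v → v ≡ w → SameOrbit A u w
  SameOrbit-≡-target (g , g∈A , gu≡v) v≡w = g , g∈A , trans gu≡v v≡w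

  SameOrbit-sym : ∀ {u v} → SameOrbit A u v → SameOrbit A v u
  SameOrbit-sym (g , g∈A , gu≡v) =
    flip g , inv-∈ A g∈A , trans (cong (g ⟨$⟩ˡ_) (sym gu≡v)) (inverseˡ g)

  SameOrbit-trans : ∀ {u v w} → SameOrbit A u v → SameOrbit A v w →
    SameOrbit A u w
  SameOrbit-trans (g , g∈A , gu≡v) (h , h∈A , hv≡w) =
    g ∘ₚ h , ∘-∈ A g∈A h∈A , trans (cong (h ⟨$⟩ʳ_) gu≡v) hv≡w

  InNOrOrbit⇒SameOrbits : ∀ {v w x y} → InNOrOrbit A v w x y →
    (SameOrbit A v x × SameOrbit A w y) ⊎ (SameOrbit A v y × SameOrbit A w x)
  InNOrOrbit⇒SameOrbits (g , g∈A , inj₁ (gv≡x , gw≡y)) =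
    inj₁ ((g , g∈A , gv≡x) , (g , g∈A , gw≡y))
  InNOrOrbit⇒SameOrbits (g , g∈A , inj₂ (gv≡y , gw≡x)) =
    inj₂ ((g , g∈A , gv≡y) , (g , g∈A , gw≡x))

  movesWithinOrbits⇒PreservesOrbits : ∀ (σ : Permutation′ n) →
    (∀ v → SameOrbit A v (σ ⟨$⟩ʳ v)) → PreservesOrbits A σ
  movesWithinOrbits⇒PreservesOrbits σ moves = moves , λ v →
    σ ⟨$⟩ˡ v ,
    SameOrbit-sym (SameOrbit-≡-target (moves (σ ⟨$⟩ˡ v)) (inverseʳ σ)) ,
    inverseʳ σ

fresh : ∀ {m} (x y : Fin (suc (suc (suc m)))) → ∃ λ z → x ≢ z × y ≢ z
fresh zero          zero          = suc zero       , (λ ()) , (λ ())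
fresh zero          (suc zero)    = suc (suc zero) , (λ ()) , (λ ())
fresh zero          (suc (suc _)) = suc zero       , (λ ()) , (λ ())
fresh (suc zero)    zero          = suc (suc zero) , (λ ()) , (λ ())
fresh (suc zero)    (suc _)       = zero           , (λ ()) , (λ ())
fresh (suc (suc _)) zero          = suc zero       , (λ ()) , (λ ())
fresh (suc (suc _)) (suc _)       = zero           , (λ ()) , (λ ())

InBar⇒movesWithinOrbits : ∀ {m} (A : PermGroup (suc (suc (suc m))))
  (σ : Permutation′ (suc (suc (suc m)))) → InBar A σ →
  ∀ v → SameOrbit A v (σ ⟨$⟩ʳ v)
InBar⇒movesWithinOrbits A σ (into , _) v
  with z , v≢z , σv≢z ← fresh v (σ ⟨$⟩ʳ v)
  with InNOrOrbit⇒SameOrbits A (into v z v≢z)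
... | inj₁ (v~σv , _) = v~σv
... | inj₂ (_ , z~σv)
  with InNOrOrbit⇒SameOrbits A (into v (σ ⟨$⟩ˡ z) v≢σ⁻¹z)
  where
  v≢σ⁻¹z : v ≢ σ ⟨$⟩ˡ z
  v≢σ⁻¹z v≡σ⁻¹z = σv≢z (trans (cong (σ ⟨$⟩ʳ_) v≡σ⁻¹z) (inverseʳ σ))
... | inj₁ (v~σv , _) = v~σv
... | inj₂ (v~σσ⁻¹z , _) =
  SameOrbit-trans A (SameOrbit-≡-target A v~σσ⁻¹z (inverseʳ σ)) z~σv

Fin1-fixed : ∀ (σ : Permutation′ 1) v → σ ⟨$⟩ʳ v ≡ v
Fin1-fixed σ zero with σ ⟨$⟩ʳ zero
... | zero = refl

Fin2-avoiding-equal : ∀ {x y v : Fin 2} → x ≢ v → y ≢ v → x ≡ y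
Fin2-avoiding-equal {zero}     {zero}     _   _   = refl
Fin2-avoiding-equal {suc zero} {suc zero} _   _   = refl
Fin2-avoiding-equal {zero}     {suc zero} {zero}     x≢v _   = ⊥-elim (x≢v refl)
Fin2-avoiding-equal {zero}     {suc zero} {suc zero} _   y≢v = ⊥-elim (y≢v refl)
Fin2-avoiding-equal {suc zero} {zero}     {zero}     _   y≢v = ⊥-elim (y≢v refl)
Fin2-avoiding-equal {suc zero} {zero}     {suc zero} x≢v _   = ⊥-elim (x≢v refl)

Fin2-≈-from-point : ∀ (σ τ : Permutation′ 2) v →
  σ ⟨$⟩ʳ v ≡ τ ⟨$⟩ʳ v → σ ≈ τ
Fin2-≈-from-point σ τ v σv≡τv i with i ≟ v
... | yes refl = σv≡τv
... | no i≢v = Fin2-avoiding-equal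
  (λ σi≡σv → i≢v (⟨$⟩ʳ-injective σ σi≡σv))
  (λ τi≡σv → i≢v (⟨$⟩ʳ-injective τ (trans τi≡σv σv≡τv)))

Fin2-moving-non-member⇒trivial : ∀ (A : PermGroup 2) (a : Permutation′ 2) v →
  a ⟨$⟩ʳ v ≢ v → ¬ (A ∈A) a → ∀ σ → (A ∈A) σ → σ ≈ id
Fin2-moving-non-member⇒trivial A a v av≢v a∉A σ σ∈A with σ ⟨$⟩ʳ v ≟ v
... | yes σv≡v = Fin2-≈-from-point σ id v σv≡v
... | no σv≢v = ⊥-elim (a∉A (∈-resp-≈ A σ≈a σ∈A))
  where
  σ≈a : σ ≈ a
  σ≈a = Fin2-≈-from-point σ a v (Fin2-avoiding-equal σv≢v av≢v)

non-member-movesWithinOrbits : ∀ n (A : PermGroup n) → ¬ IsI₂ A →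
  ∀ a → InBar A a → ¬ (A ∈A) a → ∀ v → SameOrbit A v (a ⟨$⟩ʳ v)
non-member-movesWithinOrbits 0 _ _ _ _ _ ()
non-member-movesWithinOrbits 1 A _ a _ _ v = SameOrbit-fixed A a (Fin1-fixed a v)
non-member-movesWithinOrbits 2 A ¬I₂ a _ a∉A v with a ⟨$⟩ʳ v ≟ v
... | yes av≡v = SameOrbit-fixed A a av≡v
... | no av≢v =
  ⊥-elim (¬I₂ (refl , Fin2-moving-non-member⇒trivial A a v av≢v a∉A))
non-member-movesWithinOrbits (suc (suc (suc _))) A _ a a∈Ā _ =
  InBar⇒movesWithinOrbits A a a∈Ā

lemma3p1 : (n : ℕ) (A : PermGroup n) → ¬ InGR A → ¬ IsI₂ A →
    (a : Permutation′ n) → InBar A a → ¬ (A ∈A) a → PreservesOrbits A a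
lemma3p1 n A _ ¬I₂ a a∈Ā a∉A =
  movesWithinOrbits⇒PreservesOrbits A a
    (non-member-movesWithinOrbits n A ¬I₂ a a∈Ā a∉A)
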